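{- Let $p,q,k,e$ be positive integers such that $p>2$, $q>kp+2$ and $e=p(q-k)$. Then, up to isomorphism, the graphs in $\mathcal{K}(p,q,e)$ that are of the form ${}^eK_{s,t}$ or $K^e_{s,t}$ for some positive integers $s\le t$ are exactly the $k$ graphs ${}^eK_{p,q-a}$, $a=0,1,\ldots,k-1$. Moreover, ${}^eK_{p,q-a}$ is the bipartite graph with parts $\{x_1,\ldots,x_p\}$ and $\{y_1,\ldots,y_{q-a}\}$ in which $x_iy_j$ is an edge iff $j\le d_i$, where $(d_1,\ldots,d_p)=(q-a,\ldots,q-a,\,q-a-(k-a)p)$ with $p-1$ entries equal to $q-a$.
   Context: For positive integers $p\le q$ and $e<pq$, $\mathcal{K}(p,q,e)$ is the family of subgraphs of the complete bipartite graph $K_{p,q}$ (parts of orders $p$ and $q$) having exactly $e$ edges, no isolated vertices, and which are not complete bipartite graphs. For positive integers $s\le t$: if $st-t<e<st$, ${}^eK_{s,t}$ denotes the graph obtained from $K_{s,t}$ by deleting $st-e$ edges all incident with one common vertex in the part of order $s$; if $st-s<e<st$, $K^e_{s,t}$ denotes the graph obtained from $K_{s,t}$ by deleting $st-e$ edges all incident with one common vertex in the part of order $t$. (These are the graphs "obtained from a complete bipartite graph by adding one vertex and a corresponding number of edges".) -}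

module Defs where

open import Data.Nat using (ℕ; zero; suc; _+_; _*_; _∸_; _≤_; _<_; _≡ᵇ_; _<ᵇ_; _≤ᵇ_)
open import Data.Bool using (Bool; true; false; if_then_else_; _∧_)
open import Data.Fin using (Fin; toℕ; splitAt)
open import Data.Sum using (_⊎_; inj₁; inj₂)
open import Data.Product using (Σ; ∃; _×_; _,_; Σ-syntax; ∃-syntax)
open import Relation.Binary.PropositionalEquality using (_≡_; refl)
open import Relation.Nullary using (¬_)
open import Function.Bundles using (_⤖_; Bijection)
open import Function.Definitions using (Injective)

record Graph : Set where
  field
    n      : ℕ
    adj    : Fin n → Fin n → Bool
    sym    : ∀ i j → adj i j ≡ adj j i
    irrefl : ∀ i → adj i i ≡ false
open Graph public

sumF : ∀ {m} → (Fin m → ℕ) → ℕ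
sumF {zero}  f = 0
sumF {suc m} f = f Fin.zero + sumF (λ i → f (Fin.suc i))

edgeCount : Graph → ℕ
edgeCount G = sumF λ i → sumF λ j →
  if (toℕ i <ᵇ toℕ j) ∧ adj G i j then 1 else 0

_≅_ : Graph → Graph → Set
G ≅ H = Σ[ f ∈ (Fin (n G) ⤖ Fin (n H)) ]
          (∀ i j → adj H (Bijection.to f i) (Bijection.to f j) ≡ adj G i j)

NoIsolated : Graph → Set
NoIsolated G = ∀ v → ∃[ w ] (adj G v w ≡ true)

-- Bipartite graph with parts Fin s (vertices 0..s-1) and Fin t
-- (vertices s..s+t-1), edge set given by R

private
  bipAdj : ∀ {s t} → (Fin s → Fin t → Bool) → Fin s ⊎ Fin t → Fin s ⊎ Fin t → Bool
  bipAdj R (inj₁ i) (inj₁ _) = false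
  bipAdj R (inj₁ i) (inj₂ j) = R i j
  bipAdj R (inj₂ j) (inj₁ i) = R i j
  bipAdj R (inj₂ _) (inj₂ _) = false

  bipSym : ∀ {s t} (R : Fin s → Fin t → Bool) x y → bipAdj R x y ≡ bipAdj R y x
  bipSym R (inj₁ _) (inj₁ _) = refl
  bipSym R (inj₁ _) (inj₂ _) = refl
  bipSym R (inj₂ _) (inj₁ _) = refl
  bipSym R (inj₂ _) (inj₂ _) = refl

  bipIrr : ∀ {s t} (R : Fin s → Fin t → Bool) x → bipAdj R x x ≡ false
  bipIrr R (inj₁ _) = refl
  bipIrr R (inj₂ _) = refl

Bip : (s t : ℕ) → (Fin s → Fin t → Bool) → Graph
Bip s t R = record
  { n      = s + t
  ; adj    = λ u v → bipAdj R (splitAt s u) (splitAt s v)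
  ; sym    = λ u v → bipSym R (splitAt s u) (splitAt s v)
  ; irrefl = λ u → bipIrr R (splitAt s u)
  }

K : ℕ → ℕ → Graph
K s t = Bip s t (λ _ _ → true)

SubgraphOfK : ℕ → ℕ → Graph → Set
SubgraphOfK p q G =
  Σ[ f ∈ (Fin (n G) → Fin (p + q)) ]
    (Injective _≡_ _≡_ f ×
     (∀ i j → adj G i j ≡ true → adj (K p q) (f i) (f j) ≡ true))

InFamily : ℕ → ℕ → ℕ → Graph → Set
InFamily p q e G =
  SubgraphOfK p q G × edgeCount G ≡ e × NoIsolated G ×
  (∀ s t → ¬ (G ≅ K s t))

-- ^eK_{s,t}: delete s*t-e edges at vertex x_1 (index 0) of the s-part,
-- namely those to y_1,…,y_{st-e}
leftK : ℕ → ℕ → ℕ → Graph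
leftK e s t = Bip s t λ i j →
  if toℕ i ≡ᵇ 0 then (s * t ∸ e) ≤ᵇ toℕ j else true

-- K^e_{s,t}: delete s*t-e edges at vertex y_1 (index 0) of the t-part
rightK : ℕ → ℕ → ℕ → Graph
rightK e s t = Bip s t λ i j →
  if toℕ j ≡ᵇ 0 then (s * t ∸ e) ≤ᵇ toℕ i else true

IsLeftForm : ℕ → Graph → Set
IsLeftForm e G = ∃[ s ] ∃[ t ]
  (1 ≤ s × s ≤ t × s * t ∸ t < e × e < s * t × G ≅ leftK e s t)

IsRightForm : ℕ → Graph → Set
IsRightForm e G = ∃[ s ] ∃[ t ]
  (1 ≤ s × s ≤ t × s * t ∸ s < e × e < s * t × G ≅ rightK e s t)

-- The explicit graph: parts {x_1..x_p}, {y_1..y_m}, x_i y_j an edge iff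
-- j ≤ d_i (0-indexed: toℕ j < d i)
DegGraph : (p m : ℕ) → (Fin p → ℕ) → Graph
DegGraph p m d = Bip p m λ i j → toℕ j <ᵇ d i

dSeq : (p q k a : ℕ) → Fin p → ℕ
dSeq p q k a i =
  if toℕ i ≡ᵇ (p ∸ 1) then q ∸ a ∸ (k ∸ a) * p else q ∸ a

-- A graph ^eK_{s,t} with s ≥ 2 (or K^e_{s,t} with t ≥ 2) has, in each part, a vertex adjacent to the
-- whole other part, so it is connected and every embedding into K_{p,q} sends its parts
-- into the two sides: {s,t} fits into {p,q}. With e = p(q−k) and (p−1)k < q−k, counting edges then
-- forces s = p and q−k < t ≤ q, i.e. t = q−a with a < k; for K^e_{p,t} the bounds p(t−1) < e < pt
-- would put q−k strictly between t−1 and t. (For s = 1 some y is isolated.) Conversely every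
-- ^eK_{p,q−a} lies in the family, different a give different vertex counts, and reversing the order
-- of both parts turns ^eK_{p,q−a} into the stated degree-sequence graph.
module Submission where

open import Defs hiding (sym)
open import Data.Nat
open import Data.Nat.Properties
open import Data.Bool using (Bool; true; false; not; _xor_; _∧_; if_then_else_)
open import Data.Fin as Fin using (Fin; toℕ; _↑ˡ_; _↑ʳ_; splitAt; join; fromℕ<; inject≤; opposite)
open import Data.Fin.Properties
  using (toℕ-↑ˡ; toℕ-↑ʳ; toℕ-fromℕ<; toℕ<n; splitAt-↑ʳ; splitAt-join; join-splitAt;
         inject≤-injective; opposite-prop; opposite-involutive; cantor-schröder-bernstein;
         toℕ-injective; injective⇒≤)
open import Data.Bool.Properties using (∧-zeroʳ; not-involutive)
open import Data.Sum as Sum using (_⊎_; inj₁; inj₂)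
open import Data.Sum.Properties using (inj₁-injective; inj₂-injective)
open import Data.Product using (_,_; _×_; proj₁; proj₂; ∃; ∃-syntax)
open import Data.Empty using (⊥-elim)
open import Function using (_∘_; id)
open import Function.Bundles using (Bijection; Surjection; _⤖_; _⇔_; mk⇔; mk↔ₛ′)
open import Function.Construct.Symmetry using (⤖-sym)
open import Function.Construct.Composition using (_⤖-∘_)
open import Function.Definitions using (Injective)
open import Function.Properties.Bijection using (⤖⇒↔)
open import Function.Properties.Inverse using (↔⇒⤖)
open import Relation.Binary.PropositionalEquality
open import Relation.Nullary using (¬_)
open import Relation.Binary.Definitions using (tri<; tri≈; tri>)
open import Relation.Nullary.Decidable using (dec-true; dec-false; does-⇔)
import Algebra.Properties.CommutativeMonoid.Sum as CommutativeMonoidSum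

private module ∑ = CommutativeMonoidSum +-0-commutativeMonoid

<ᵇ≡true : ∀ {m n} → m < n → (m <ᵇ n) ≡ true
<ᵇ≡true {m} {n} = dec-true (m <? n)

<ᵇ≡false : ∀ {m n} → ¬ m < n → (m <ᵇ n) ≡ false
<ᵇ≡false {m} {n} = dec-false (m <? n)

≤ᵇ≡true : ∀ {m n} → m ≤ n → (m ≤ᵇ n) ≡ true
≤ᵇ≡true {m} {n} = dec-true (m ≤? n)

≤ᵇ≡false : ∀ {m n} → ¬ m ≤ n → (m ≤ᵇ n) ≡ false
≤ᵇ≡false {m} {n} = dec-false (m ≤? n)

≡ᵇ≡true : ∀ n → (n ≡ᵇ n) ≡ true
≡ᵇ≡true n = dec-true (n ≟ n) refl

≡ᵇ≡false : ∀ {m n} → m ≢ n → (m ≡ᵇ n) ≡ false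
≡ᵇ≡false {m} {n} = dec-false (m ≟ n)

false≢true : false ≢ true
false≢true ()

indicator : Bool → ℕ
indicator b = if b then 1 else 0

sumF≡sum : ∀ {m} (f : Fin m → ℕ) → sumF f ≡ ∑.sum f
sumF≡sum {zero}  f = refl
sumF≡sum {suc m} f = cong (f Fin.zero +_) (sumF≡sum (f ∘ Fin.suc))

sumF-cong : ∀ {m} {f g : Fin m → ℕ} → (∀ i → f i ≡ g i) → sumF f ≡ sumF g
sumF-cong {zero}  f≗g = refl
sumF-cong {suc m} f≗g = cong₂ _+_ (f≗g Fin.zero) (sumF-cong (f≗g ∘ Fin.suc))

sumF-const : ∀ m c → sumF {m} (λ _ → c) ≡ m * c
sumF-const zero    c = refl
sumF-const (suc m) c = cong (c +_) (sumF-const m c)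

sumF-distrib-+ : ∀ {m} (f g : Fin m → ℕ) → sumF (λ i → f i + g i) ≡ sumF f + sumF g
sumF-distrib-+ {m} f g = begin
  sumF {m} (λ i → f i + g i)  ≡⟨ sumF≡sum (λ i → f i + g i) ⟩
  ∑.sum (λ i → f i + g i) ≡⟨ ∑.∑-distrib-+ f g ⟩
  ∑.sum f + ∑.sum g       ≡⟨ sym (cong₂ _+_ (sumF≡sum f) (sumF≡sum g)) ⟩
  sumF f + sumF g         ∎
  where open ≡-Reasoning

sumF-comm : ∀ {m k} (f : Fin m → Fin k → ℕ) →
  sumF (λ i → sumF (f i)) ≡ sumF (λ j → sumF (λ i → f i j))
sumF-comm {m} {k} f = begin
  sumF {m} (λ i → sumF (f i))          ≡⟨ sumF-cong (sumF≡sum ∘ f) ⟩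
  sumF {m} (λ i → ∑.sum (f i))         ≡⟨ sumF≡sum (∑.sum ∘ f) ⟩
  ∑.sum (λ i → ∑.sum (f i))            ≡⟨ ∑.∑-comm f ⟩
  ∑.sum (λ j → ∑.sum (λ i → f i j))    ≡⟨ sym (sumF≡sum (∑.sum ∘ fᵀ)) ⟩
  sumF {k} (λ j → ∑.sum (λ i → f i j)) ≡⟨ sym (sumF-cong {k} (sumF≡sum ∘ fᵀ)) ⟩
  sumF {k} (λ j → sumF (λ i → f i j))  ∎
  where
  open ≡-Reasoning
  fᵀ : Fin k → Fin m → ℕ
  fᵀ j i = f i j

sumF-permute : ∀ {m k} (π : Fin m ⤖ Fin k) (f : Fin k → ℕ) →
  sumF f ≡ sumF (f ∘ Bijection.to π)
sumF-permute {m} π f = begin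
  sumF f                       ≡⟨ sumF≡sum f ⟩
  ∑.sum f                      ≡⟨ ∑.sum-permute f (⤖⇒↔ π) ⟩
  ∑.sum (f ∘ Bijection.to π)   ≡⟨ sym (sumF≡sum (f ∘ Bijection.to π)) ⟩
  sumF {m} (f ∘ Bijection.to π) ∎
  where open ≡-Reasoning

sumF-zero : ∀ {m} {f : Fin m → ℕ} → (∀ i → f i ≡ 0) → sumF f ≡ 0
sumF-zero {m} f≗0 = trans (sumF-cong f≗0) (trans (sumF-const m 0) (*-zeroʳ m))

sumF-join : ∀ m k (f : Fin (m + k) → ℕ) →
  sumF f ≡ sumF (f ∘ (_↑ˡ k)) + sumF (f ∘ (m ↑ʳ_))
sumF-join zero    k f = refl
sumF-join (suc m) k f =
  trans (cong (f Fin.zero +_) (sumF-join m k (f ∘ Fin.suc))) (sym (+-assoc (f Fin.zero) _ _))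

sumF-≤ᵇ : ∀ {c t} → c ≤ t → sumF {t} (λ j → indicator (c ≤ᵇ toℕ j)) ≡ t ∸ c
sumF-≤ᵇ {c} {t} c≤t with t ∸ c | m+[n∸m]≡n c≤t
... | r | refl = begin
  sumF {c + r} (λ j → indicator (c ≤ᵇ toℕ j))
    ≡⟨ sumF-join c r _ ⟩
  sumF {c} (λ i → indicator (c ≤ᵇ toℕ (i ↑ˡ r))) +
  sumF {r} (λ j → indicator (c ≤ᵇ toℕ (c ↑ʳ j)))
    ≡⟨ cong₂ _+_ (sumF-zero below) (trans (sumF-cong {r} above) (sumF-const r 1)) ⟩
  r * 1
    ≡⟨ *-identityʳ r ⟩
  r ∎
  where
  open ≡-Reasoning
  below : ∀ i → indicator (c ≤ᵇ toℕ (i ↑ˡ r)) ≡ 0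
  below i = cong indicator (≤ᵇ≡false (<⇒≱ (subst (_< c) (sym (toℕ-↑ˡ i r)) (toℕ<n i))))
  above : ∀ j → indicator (c ≤ᵇ toℕ (c ↑ʳ j)) ≡ 1
  above j = cong indicator (≤ᵇ≡true (subst (c ≤_) (sym (toℕ-↑ʳ c j)) (m≤m+n c (toℕ j))))

≅-sym : ∀ {G H} → G ≅ H → H ≅ G
≅-sym {G} {H} (π , pres) = ⤖-sym π , λ u v →
  trans (sym (pres (to⁻ u) (to⁻ v))) (cong₂ (adj H) (to∘to⁻ u) (to∘to⁻ v))
  where
  open Bijection π using (to; to⁻; surjection)
  open Surjection surjection using (to∘to⁻)

≅-trans : ∀ {G H L} → G ≅ H → H ≅ L → G ≅ L
≅-trans (π , presπ) (ρ , presρ) = ρ ⤖-∘ π , λ u v → trans (presρ _ _) (presπ u v)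

≅⇒n≡ : ∀ {G H} → G ≅ H → n G ≡ n H
≅⇒n≡ (π , _) = cantor-schröder-bernstein (Bijection.injective π) (Bijection.injective (⤖-sym π))

noIsolated-≅ : ∀ {G H} → G ≅ H → NoIsolated G → NoIsolated H
noIsolated-≅ {G} {H} (π , pres) noIso v =
  to w , trans (cong (λ x → adj H x (to w)) (sym (to∘to⁻ v))) (trans (pres _ w) vw)
  where
  open Bijection π using (to; to⁻; surjection)
  open Surjection surjection using (to∘to⁻)
  w = proj₁ (noIso (to⁻ v))
  vw = proj₂ (noIso (to⁻ v))

subgraphOfK-≅ : ∀ {G H p q} → G ≅ H → SubgraphOfK p q G → SubgraphOfK p q H
subgraphOfK-≅ {G} {H} G≅H (φ , φ-inj , φ-edge) with ≅-sym {G} {H} G≅H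
... | π , pres = φ ∘ Bijection.to π , Bijection.injective π ∘ φ-inj ,
                 λ u v uv → φ-edge _ _ (trans (pres u v) uv)

degreeSum : Graph → ℕ
degreeSum G = sumF λ i → sumF λ j → indicator (adj G i j)

degreeSum-≅ : ∀ {G H} → G ≅ H → degreeSum G ≡ degreeSum H
degreeSum-≅ {G} {H} (π , pres) = sym (begin
  degreeSum H
    ≡⟨ sumF-permute π _ ⟩
  sumF {n G} (λ i → sumF (λ v → indicator (adj H (to i) v)))
    ≡⟨ sumF-cong (λ i → sumF-permute π (λ v → indicator (adj H (to i) v))) ⟩
  sumF {n G} (λ i → sumF {n G} (λ j → indicator (adj H (to i) (to j))))
    ≡⟨ sumF-cong (λ i → sumF-cong (λ j → cong indicator (pres i j))) ⟩
  degreeSum G ∎)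
  where
  open Bijection π using (to)
  open ≡-Reasoning

indicator-adj-split : ∀ G i j → indicator (adj G i j) ≡
  indicator ((toℕ i <ᵇ toℕ j) ∧ adj G i j) + indicator ((toℕ j <ᵇ toℕ i) ∧ adj G j i)
indicator-adj-split G i j with <-cmp (toℕ i) (toℕ j)
... | tri< i<j _ j≮i rewrite <ᵇ≡true i<j | <ᵇ≡false j≮i = sym (+-identityʳ _)
... | tri> i≮j _ j<i rewrite <ᵇ≡false i≮j | <ᵇ≡true j<i = cong indicator (Graph.sym G i j)
... | tri≈ _ i≡j _ rewrite toℕ-injective i≡j | irrefl G j | ∧-zeroʳ (toℕ j <ᵇ toℕ j) = refl

handshake : ∀ G → degreeSum G ≡ 2 * edgeCount G
handshake G = begin
  degreeSum G
    ≡⟨ sumF-cong (λ i → sumF-cong (indicator-adj-split G i)) ⟩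
  sumF (λ i → sumF (λ j → upper i j + lower i j))
    ≡⟨ sumF-cong (λ i → sumF-distrib-+ (upper i) (lower i)) ⟩
  sumF (λ i → sumF (upper i) + sumF (lower i))
    ≡⟨ sumF-distrib-+ (λ i → sumF (upper i)) (λ i → sumF (lower i)) ⟩
  edgeCount G + sumF (λ i → sumF (lower i))
    ≡⟨ cong (edgeCount G +_) (sumF-comm lower) ⟩
  edgeCount G + edgeCount G
    ≡⟨ cong (edgeCount G +_) (sym (+-identityʳ _)) ⟩
  2 * edgeCount G ∎
  where
  open ≡-Reasoning
  upper lower : Fin (n G) → Fin (n G) → ℕ
  upper i j = indicator ((toℕ i <ᵇ toℕ j) ∧ adj G i j)
  lower i j = indicator ((toℕ j <ᵇ toℕ i) ∧ adj G j i)

edgeCount-≅ : ∀ {G H} → G ≅ H → edgeCount G ≡ edgeCount H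
edgeCount-≅ {G} {H} G≅H = *-cancelˡ-≡ _ _ 2
  (trans (sym (handshake G)) (trans (degreeSum-≅ {G} {H} G≅H) (handshake H)))

join-injective : ∀ m n → Injective _≡_ _≡_ (join m n)
join-injective m n {x} {y} e =
  trans (sym (splitAt-join m n x)) (trans (cong (splitAt m) e) (splitAt-join m n y))

splitAt-injective : ∀ m n → Injective _≡_ _≡_ (splitAt m {n})
splitAt-injective m n {u} {v} e =
  trans (sym (join-splitAt m n u)) (trans (cong (join m n) e) (join-splitAt m n v))

injective-through⇒≤ : ∀ {m n} {C : Set} {f : Fin m → C} (g : Fin n → C) → Injective _≡_ _≡_ f →
  (∀ x → ∃ λ y → f x ≡ g y) → m ≤ n
injective-through⇒≤ g f-inj through = injective⇒≤ λ {x} {y} e →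
  f-inj (trans (proj₂ (through x)) (trans (cong g e) (sym (proj₂ (through y)))))

-- The adjacency of Bip is private to Defs; this is a copy of it.
bip : ∀ {s t} → (Fin s → Fin t → Bool) → Fin s ⊎ Fin t → Fin s ⊎ Fin t → Bool
bip R (inj₁ _) (inj₁ _) = false
bip R (inj₁ i) (inj₂ j) = R i j
bip R (inj₂ j) (inj₁ i) = R i j
bip R (inj₂ _) (inj₂ _) = false

Bip-adj : ∀ s t R u v → adj (Bip s t R) u v ≡ bip R (splitAt s u) (splitAt s v)
Bip-adj s t R u v with splitAt s u | splitAt s v
... | inj₁ _ | inj₁ _ = refl
... | inj₁ _ | inj₂ _ = refl
... | inj₂ _ | inj₁ _ = refl
... | inj₂ _ | inj₂ _ = refl

Bip-adj-join : ∀ s t R x y → adj (Bip s t R) (join s t x) (join s t y) ≡ bip R x y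
Bip-adj-join s t R x y =
  trans (Bip-adj s t R _ _) (cong₂ (bip R) (splitAt-join s t x) (splitAt-join s t y))

Bip-≅ : ∀ {s t} {R R′ : Fin s → Fin t → Bool} (f : Fin s → Fin s) (g : Fin t → Fin t) →
  (∀ i → f (f i) ≡ i) → (∀ j → g (g j) ≡ j) → (∀ i j → R′ (f i) (g j) ≡ R i j) →
  Bip s t R ≅ Bip s t R′
Bip-≅ {s} {t} {R} {R′} f g f-invol g-invol R′∘fg≡R =
  ↔⇒⤖ (mk↔ₛ′ σ σ σ-invol σ-invol) , σ-adj
  where
  relabel : Fin s ⊎ Fin t → Fin s ⊎ Fin t
  relabel = Sum.map f g

  relabel-invol : ∀ x → relabel (relabel x) ≡ x
  relabel-invol (inj₁ i) = cong inj₁ (f-invol i)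
  relabel-invol (inj₂ j) = cong inj₂ (g-invol j)

  relabel-adj : ∀ x y → bip R′ (relabel x) (relabel y) ≡ bip R x y
  relabel-adj (inj₁ _) (inj₁ _) = refl
  relabel-adj (inj₁ i) (inj₂ j) = R′∘fg≡R i j
  relabel-adj (inj₂ j) (inj₁ i) = R′∘fg≡R i j
  relabel-adj (inj₂ _) (inj₂ _) = refl

  σ : Fin (s + t) → Fin (s + t)
  σ = join s t ∘ relabel ∘ splitAt s

  σ-invol : ∀ u → σ (σ u) ≡ u
  σ-invol u = begin
    join s t (relabel (splitAt s (join s t (relabel (splitAt s u)))))
      ≡⟨ cong (join s t ∘ relabel) (splitAt-join s t (relabel (splitAt s u))) ⟩
    join s t (relabel (relabel (splitAt s u)))
      ≡⟨ cong (join s t) (relabel-invol (splitAt s u)) ⟩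
    join s t (splitAt s u)
      ≡⟨ join-splitAt s t u ⟩
    u ∎
    where open ≡-Reasoning

  σ-adj : ∀ u v → adj (Bip s t R′) (σ u) (σ v) ≡ adj (Bip s t R) u v
  σ-adj u v = trans (Bip-adj-join s t R′ (relabel (splitAt s u)) (relabel (splitAt s v)))
    (trans (relabel-adj (splitAt s u) (splitAt s v)) (sym (Bip-adj s t R u v)))

Bip-noIsolated : ∀ {s t} {R : Fin s → Fin t → Bool} →
  (∀ i → ∃ λ j → R i j ≡ true) → (∀ j → ∃ λ i → R i j ≡ true) → NoIsolated (Bip s t R)
Bip-noIsolated {s} {t} {R} rows cols u =
  join s t (proj₁ (neighbour (splitAt s u))) ,
  trans (Bip-adj s t R u _)
    (trans (cong (bip R (splitAt s u)) (splitAt-join s t (proj₁ (neighbour (splitAt s u)))))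
      (proj₂ (neighbour (splitAt s u))))
  where
  neighbour : ∀ x → ∃ λ y → bip R x y ≡ true
  neighbour (inj₁ i) = inj₂ (proj₁ (rows i)) , proj₂ (rows i)
  neighbour (inj₂ j) = inj₁ (proj₁ (cols j)) , proj₂ (cols j)

Bip-isolated : ∀ {s t} {R : Fin s → Fin t → Bool} (j : Fin t) →
  (∀ i → R i j ≡ false) → ¬ NoIsolated (Bip s t R)
Bip-isolated {s} {t} {R} j empty noIso with noIso (s ↑ʳ j)
... | w , jw = false≢true (trans (sym no-neighbour) jw)
  where
  empty-row : ∀ x → bip R (inj₂ j) x ≡ false
  empty-row (inj₁ i) = empty i
  empty-row (inj₂ _) = refl
  no-neighbour : adj (Bip s t R) (s ↑ʳ j) w ≡ false
  no-neighbour = trans (Bip-adj s t R _ w)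
    (trans (cong (λ x → bip R x (splitAt s w)) (splitAt-↑ʳ s t j)) (empty-row (splitAt s w)))

degreeSum-Bip : ∀ s t R → degreeSum (Bip s t R) ≡ 2 * sumF (λ i → sumF (λ j → indicator (R i j)))
degreeSum-Bip s t R = begin
  degreeSum (Bip s t R)
    ≡⟨ sumF-join s t row ⟩
  sumF (λ i → row (i ↑ˡ t)) + sumF (λ j → row (s ↑ʳ j))
    ≡⟨ cong₂ _+_ (sumF-cong left-row) (trans (sumF-cong right-row) (sym (sumF-comm R₁))) ⟩
  ∑R + ∑R
    ≡⟨ cong (∑R +_) (sym (+-identityʳ ∑R)) ⟩
  2 * ∑R ∎
  where
  open ≡-Reasoning
  R₁ : Fin s → Fin t → ℕ
  R₁ i j = indicator (R i j)
  ∑R = sumF (λ i → sumF (R₁ i))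
  row : Fin (s + t) → ℕ
  row u = sumF (λ v → indicator (adj (Bip s t R) u v))
  left-row : ∀ i → row (i ↑ˡ t) ≡ sumF (R₁ i)
  left-row i = trans (sumF-join s t _) (cong₂ _+_
    (sumF-zero (λ i′ → cong indicator (Bip-adj-join s t R (inj₁ i) (inj₁ i′))))
    (sumF-cong (λ j → cong indicator (Bip-adj-join s t R (inj₁ i) (inj₂ j)))))
  right-row : ∀ j → row (s ↑ʳ j) ≡ sumF (λ i → R₁ i j)
  right-row j = trans (sumF-join s t _) (trans (cong₂ _+_
    (sumF-cong (λ i → cong indicator (Bip-adj-join s t R (inj₂ j) (inj₁ i))))
    (sumF-zero (λ j′ → cong indicator (Bip-adj-join s t R (inj₂ j) (inj₂ j′)))))
    (+-identityʳ _))

edgeCount-Bip : ∀ s t R → edgeCount (Bip s t R) ≡ sumF (λ i → sumF (λ j → indicator (R i j)))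
edgeCount-Bip s t R = *-cancelˡ-≡ _ _ 2 (trans (sym (handshake (Bip s t R))) (degreeSum-Bip s t R))

Bip⊆K : ∀ {s t q} (R : Fin s → Fin t → Bool) → t ≤ q → SubgraphOfK s q (Bip s t R)
Bip⊆K {s} {t} {q} R t≤q = φ , φ-injective , φ-edge
  where
  widen : Fin s ⊎ Fin t → Fin s ⊎ Fin q
  widen = Sum.map id (λ j → inject≤ j t≤q)

  widen-injective : Injective _≡_ _≡_ widen
  widen-injective {inj₁ _} {inj₁ _} e = cong inj₁ (inj₁-injective e)
  widen-injective {inj₂ _} {inj₂ _} e = cong inj₂ (inject≤-injective t≤q t≤q _ _ (inj₂-injective e))

  widen-edge : ∀ x y → bip R x y ≡ true → bip (λ _ _ → true) (widen x) (widen y) ≡ true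
  widen-edge (inj₁ _) (inj₂ _) _ = refl
  widen-edge (inj₂ _) (inj₁ _) _ = refl

  φ : Fin (s + t) → Fin (s + q)
  φ = join s q ∘ widen ∘ splitAt s

  φ-injective : Injective _≡_ _≡_ φ
  φ-injective = splitAt-injective s t ∘ widen-injective ∘ join-injective s q

  φ-edge : ∀ u v → adj (Bip s t R) u v ≡ true → adj (K s q) (φ u) (φ v) ≡ true
  φ-edge u v uv = trans (Bip-adj-join s q _ (widen (splitAt s u)) (widen (splitAt s v)))
    (widen-edge (splitAt s u) (splitAt s v) (trans (sym (Bip-adj s t R u v)) uv))

isLeft : ∀ {A B : Set} → A ⊎ B → Bool
isLeft (inj₁ _) = true
isLeft (inj₂ _) = false

xor≡true⇒≡not : ∀ a b → a xor b ≡ true → a ≡ not b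
xor≡true⇒≡not true  false _ = refl
xor≡true⇒≡not false true  _ = refl

xor-transfer : ∀ a b c → a xor b ≡ false → a xor c ≡ true → c xor b ≡ true
xor-transfer true  true  false _ _ = refl
xor-transfer false false true  _ _ = refl
xor-transfer true  true  true  _ ()
xor-transfer false false false _ ()
xor-transfer true  false _     () _
xor-transfer false true  _     () _

K-adj : ∀ p q u v → adj (K p q) u v ≡ isLeft (splitAt p u) xor isLeft (splitAt p v)
K-adj p q u v = trans (Bip-adj p q _ u v) (complete (splitAt p u) (splitAt p v))
  where
  complete : ∀ x y → bip (λ _ _ → true) x y ≡ isLeft x xor isLeft y
  complete (inj₁ _) (inj₁ _) = refl
  complete (inj₁ _) (inj₂ _) = refl
  complete (inj₂ _) (inj₁ _) = refl
  complete (inj₂ _) (inj₂ _) = refl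

K-adj-transfer : ∀ {p q} u v w → adj (K p q) u v ≡ false → adj (K p q) u w ≡ true →
  adj (K p q) w v ≡ true
K-adj-transfer {p} {q} u v w uv uw = trans (K-adj p q w v) (xor-transfer (side u) (side v) (side w)
  (trans (sym (K-adj p q u v)) uv) (trans (sym (K-adj p q u w)) uw))
  where
  side : Fin (p + q) → Bool
  side = isLeft ∘ splitAt p

isLeft≡true⇒≤ : ∀ {m p q} {f : Fin m → Fin p ⊎ Fin q} → Injective _≡_ _≡_ f →
  (∀ i → isLeft (f i) ≡ true) → m ≤ p
isLeft≡true⇒≤ {f = f} f-inj left =
  injective-through⇒≤ inj₁ f-inj (λ i → fromLeft (f i) (left i))
  where
  fromLeft : ∀ x → isLeft x ≡ true → ∃ λ a → x ≡ inj₁ a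
  fromLeft (inj₁ a) _ = a , refl

isLeft≡false⇒≤ : ∀ {m p q} {f : Fin m → Fin p ⊎ Fin q} → Injective _≡_ _≡_ f →
  (∀ i → isLeft (f i) ≡ false) → m ≤ q
isLeft≡false⇒≤ {f = f} f-inj right =
  injective-through⇒≤ inj₂ f-inj (λ i → fromRight (f i) (right i))
  where
  fromRight : ∀ x → isLeft x ≡ false → ∃ λ b → x ≡ inj₂ b
  fromRight (inj₂ b) _ = b , refl

-- A full row and a full column make Bip s t R connected, so an embedding into K p q sends
-- each part into a single side.
Bip⊆K⇒sizes : ∀ {s t p q} {R : Fin s → Fin t → Bool} → SubgraphOfK p q (Bip s t R) →
  (x : Fin s) → (∀ j → R x j ≡ true) → (y : Fin t) → (∀ i → R i y ≡ true) →
  (s ≤ p × t ≤ q) ⊎ (s ≤ q × t ≤ p)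
Bip⊆K⇒sizes {s} {t} {p} {q} {R} (φ , φ-inj , φ-edge) x full-x y full-y = sizes (side (inj₂ y)) refl
  where
  H : Fin s ⊎ Fin t → Fin p ⊎ Fin q
  H = splitAt p ∘ φ ∘ join s t
  H-inj : Injective _≡_ _≡_ H
  H-inj = join-injective s t ∘ φ-inj ∘ splitAt-injective p q
  X-inj : Injective _≡_ _≡_ (H ∘ inj₁)
  X-inj = inj₁-injective ∘ H-inj
  Y-inj : Injective _≡_ _≡_ (H ∘ inj₂)
  Y-inj = inj₂-injective ∘ H-inj
  side : Fin s ⊎ Fin t → Bool
  side = isLeft ∘ H
  across : ∀ a b → bip R a b ≡ true → side a ≡ not (side b)
  across a b ab = xor≡true⇒≡not (side a) (side b)
    (trans (sym (K-adj p q _ _)) (φ-edge _ _ (trans (Bip-adj-join s t R a b) ab)))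
  rows : ∀ i → side (inj₁ i) ≡ not (side (inj₂ y))
  rows i = across (inj₁ i) (inj₂ y) (full-y i)
  cols : ∀ j → side (inj₂ j) ≡ side (inj₂ y)
  cols j = trans (across (inj₂ j) (inj₁ x) (full-x j))
    (trans (cong not (rows x)) (not-involutive (side (inj₂ y))))
  sizes : ∀ b → side (inj₂ y) ≡ b → (s ≤ p × t ≤ q) ⊎ (s ≤ q × t ≤ p)
  sizes false eq = inj₁ (isLeft≡true⇒≤ X-inj (λ i → trans (rows i) (cong not eq)) ,
                         isLeft≡false⇒≤ Y-inj (λ j → trans (cols j) eq))
  sizes true  eq = inj₂ (isLeft≡false⇒≤ X-inj (λ i → trans (rows i) (cong not eq)) ,
                         isLeft≡true⇒≤ Y-inj (λ j → trans (cols j) eq))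

leftRel : ℕ → (s t : ℕ) → Fin s → Fin t → Bool
leftRel e s t i j = if toℕ i ≡ᵇ 0 then (s * t ∸ e) ≤ᵇ toℕ j else true

rightRel : ℕ → (s t : ℕ) → Fin s → Fin t → Bool
rightRel e s t i j = if toℕ j ≡ᵇ 0 then (s * t ∸ e) ≤ᵇ toℕ i else true

leftRel-fullColumn : ∀ {e s t} (c<t : s * t ∸ e < t) i → leftRel e s t i (fromℕ< c<t) ≡ true
leftRel-fullColumn {s = suc _} c<t Fin.zero    = ≤ᵇ≡true (≤-reflexive (sym (toℕ-fromℕ< c<t)))
leftRel-fullColumn {s = suc _} c<t (Fin.suc _) = refl

rightRel-fullRow : ∀ {e s t} (c<s : s * t ∸ e < s) j → rightRel e s t (fromℕ< c<s) j ≡ true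
rightRel-fullRow {t = suc _} c<s Fin.zero    = ≤ᵇ≡true (≤-reflexive (sym (toℕ-fromℕ< c<s)))
rightRel-fullRow {t = suc _} c<s (Fin.suc _) = refl

edgeCount-leftK : ∀ {e s t} → 1 ≤ s → s * t ∸ e ≤ t → e ≤ s * t → edgeCount (leftK e s t) ≡ e
edgeCount-leftK {e} {suc s} {t} _ c≤t e≤st = begin
  edgeCount (leftK e (suc s) t)
    ≡⟨ edgeCount-Bip (suc s) t (leftRel e (suc s) t) ⟩
  sumF {t} (λ j → indicator (c ≤ᵇ toℕ j)) + sumF {s} (λ _ → sumF {t} (λ _ → 1))
    ≡⟨ cong₂ _+_ (sumF-≤ᵇ c≤t) (sumF-cong {s} (λ _ → trans (sumF-const t 1) (*-identityʳ t))) ⟩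
  (t ∸ c) + sumF {s} (λ _ → t)
    ≡⟨ cong (t ∸ c +_) (sumF-const s t) ⟩
  (t ∸ c) + s * t
    ≡⟨ sym (+-∸-comm (s * t) c≤t) ⟩
  suc s * t ∸ c
    ≡⟨ m∸[m∸n]≡n e≤st ⟩
  e ∎
  where
  open ≡-Reasoning
  c = suc s * t ∸ e

leftK-noIsolated : ∀ {e s t} → 2 ≤ s → s * t ∸ e < t → NoIsolated (leftK e s t)
leftK-noIsolated {s = suc zero} (s≤s ())
leftK-noIsolated {e} {suc (suc _)} _ c<t =
  Bip-noIsolated (λ i → fromℕ< c<t , leftRel-fullColumn {e} c<t i) (λ _ → Fin.suc Fin.zero , refl)

leftK⊆K⇒sizes : ∀ {e s t p q} → 2 ≤ s → s * t ∸ e < t → SubgraphOfK p q (leftK e s t) →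
  (s ≤ p × t ≤ q) ⊎ (s ≤ q × t ≤ p)
leftK⊆K⇒sizes {s = suc zero} (s≤s ())
leftK⊆K⇒sizes {e} {suc (suc _)} _ c<t L⊆K =
  Bip⊆K⇒sizes L⊆K (Fin.suc Fin.zero) (λ _ → refl) (fromℕ< c<t) (leftRel-fullColumn {e} c<t)

rightK⊆K⇒sizes : ∀ {e s t p q} → 2 ≤ t → s * t ∸ e < s → SubgraphOfK p q (rightK e s t) →
  (s ≤ p × t ≤ q) ⊎ (s ≤ q × t ≤ p)
rightK⊆K⇒sizes {t = suc zero} (s≤s ())
rightK⊆K⇒sizes {e} {t = suc (suc _)} _ c<s R⊆K =
  Bip⊆K⇒sizes R⊆K (fromℕ< c<s) (rightRel-fullRow {e} c<s) (Fin.suc Fin.zero) (λ _ → refl)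

leftK-isolated : ∀ {e t} → e < 1 * t → ¬ NoIsolated (leftK e 1 t)
leftK-isolated {e} {suc t} e<t = Bip-isolated Fin.zero empty
  where
  empty : ∀ i → leftRel e 1 (suc t) i Fin.zero ≡ false
  empty Fin.zero = ≤ᵇ≡false (<⇒≱ (m<n⇒0<n∸m e<t))

-- In K p q non-adjacent vertices have the same neighbours, but x₀ and y₀ are non-adjacent and only
-- x₀ is adjacent to y_c.
leftK-≇K : ∀ {e s t p q} → 1 ≤ s * t ∸ e → s * t ∸ e < t → ¬ (leftK e s t ≅ K p q)
leftK-≇K {e} {zero} 1≤c _ _ with () ← subst (1 ≤_) (0∸n≡0 e) 1≤c
leftK-≇K {e} {suc s} {suc t} {p} {q} 1≤c c<t (π , pres) =
  false≢true (trans (sym wb) (trans (sym (pres w b))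
    (K-adj-transfer {p} {q} (to a) (to b) (to w) (trans (pres a b) ab) (trans (pres a w) aw))))
  where
  open Bijection π using (to)
  R = leftRel e (suc s) (suc t)
  L = leftK e (suc s) (suc t)
  x₀ y₀ y_c : Fin (suc s) ⊎ Fin (suc t)
  x₀ = inj₁ Fin.zero
  y₀ = inj₂ Fin.zero
  y_c = inj₂ (fromℕ< c<t)
  a b w : Fin (suc s + suc t)
  a = join (suc s) (suc t) x₀
  b = join (suc s) (suc t) y₀
  w = join (suc s) (suc t) y_c
  ab : adj L a b ≡ false
  ab = trans (Bip-adj-join (suc s) (suc t) R x₀ y₀) (≤ᵇ≡false (<⇒≱ 1≤c))
  aw : adj L a w ≡ true
  aw = trans (Bip-adj-join (suc s) (suc t) R x₀ y_c) (leftRel-fullColumn {e} {suc s} c<t Fin.zero)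
  wb : adj L w b ≡ false
  wb = Bip-adj-join (suc s) (suc t) R y_c y₀

∸-suc<∸⇔≤ : ∀ {t c y} → y < t → (t ∸ suc y < t ∸ c ⇔ c ≤ y)
∸-suc<∸⇔≤ {t} y<t = mk⇔
  (λ lt → ≮⇒≥ (λ y<c → <⇒≱ lt (∸-monoʳ-≤ t y<c)))
  (λ c≤y → ∸-monoʳ-< (s≤s c≤y) y<t)

reversed-leftRel : ∀ {s t c x y} → x < s → y < t →
  (t ∸ suc y <ᵇ (if s ∸ suc x ≡ᵇ s ∸ 1 then t ∸ c else t)) ≡ (if x ≡ᵇ 0 then c ≤ᵇ y else true)
reversed-leftRel {s} {t} {c} {zero} {y} _ y<t rewrite ≡ᵇ≡true (s ∸ 1) =
  does-⇔ (∸-suc<∸⇔≤ y<t) (t ∸ suc y <? t ∸ c) (c ≤? y)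
reversed-leftRel {s} {t} {c} {suc x} {y} x<s y<t
  rewrite ≡ᵇ≡false (<⇒≢ (∸-monoʳ-< {s} {suc (suc x)} {1} (s≤s (s≤s z≤n)) x<s)) =
  <ᵇ≡true (∸-monoʳ-< {t} {suc y} {0} (s≤s z≤n) y<t)

-- Reversing both parts moves the deficient vertex x₀ of leftK to the last position.
leftK≅DegGraph : ∀ {e s t} (d : Fin s → ℕ) →
  (∀ i → d i ≡ (if toℕ i ≡ᵇ s ∸ 1 then t ∸ (s * t ∸ e) else t)) → leftK e s t ≅ DegGraph s t d
leftK≅DegGraph {e} {s} {t} d d-shape =
  Bip-≅ opposite opposite opposite-involutive opposite-involutive reversed
  where
  reversed : ∀ i j → (toℕ (opposite j) <ᵇ d (opposite i)) ≡ leftRel e s t i j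
  reversed i j rewrite d-shape (opposite i) | opposite-prop i | opposite-prop j =
    reversed-leftRel {c = s * t ∸ e} (toℕ<n i) (toℕ<n j)

m∸n<o⇒m∸o<n : ∀ {m n o} → 0 < n → m ∸ n < o → m ∸ o < n
m∸n<o⇒m∸o<n {m} {n} {o} 0<n m∸n<o = m<n+o⇒m∸n<o m o {{>-nonZero 0<n}} (begin-strict
  m           ≤⟨ m≤n+m∸n m n ⟩
  n + (m ∸ n) <⟨ +-monoʳ-< n m∸n<o ⟩
  n + o       ≡⟨ +-comm n o ⟩
  o + n       ∎)
  where open ≤-Reasoning

m*n∸m<m*o⇒n≤o : ∀ m {n o} → m * n ∸ m < m * o → n ≤ o
m*n∸m<m*o⇒n≤o m {n} {o} lt = ≤-trans (m≤n+m∸n n 1) (*-cancelˡ-< m (n ∸ 1) o (begin-strict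
  m * (n ∸ 1)   ≡⟨ *-distribˡ-∸ m n 1 ⟩
  m * n ∸ m * 1 ≡⟨ cong (m * n ∸_) (*-identityʳ m) ⟩
  m * n ∸ m     <⟨ lt ⟩
  m * o         ∎))
  where open ≤-Reasoning

m∸o≡[n∸o]+[m∸n] : ∀ {m n o} → o ≤ n → n ≤ m → m ∸ o ≡ (n ∸ o) + (m ∸ n)
m∸o≡[n∸o]+[m∸n] {m} {n} {o} o≤n n≤m = begin
  m ∸ o             ≡⟨ cong (_∸ o) (sym (m+[n∸m]≡n n≤m)) ⟩
  n + (m ∸ n) ∸ o   ≡⟨ +-∸-comm (m ∸ n) o≤n ⟩
  (n ∸ o) + (m ∸ n) ∎
  where open ≡-Reasoning

∸-shift : ∀ {q k t} → q ∸ k < t → t ≤ q → ∃[ a ] (a < k × t ≡ q ∸ a)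
∸-shift {q} {zero}  q<t     t≤q = ⊥-elim (<⇒≱ q<t t≤q)
∸-shift {q} {suc k} {t} q∸k<t t≤q = q ∸ t , m<n+o⇒m∸n<o q t (begin-strict
  q                   ≤⟨ m≤n+m∸n q (suc k) ⟩
  suc k + (q ∸ suc k) <⟨ +-monoʳ-< (suc k) q∸k<t ⟩
  suc k + t           ≡⟨ +-comm (suc k) t ⟩
  t + suc k           ∎) , sym (m∸[m∸n]≡n t≤q)
  where open ≤-Reasoning

kp<q⇒[p∸1]*k<q∸k : ∀ {p q k} → 1 ≤ p → k * p < q → (p ∸ 1) * k < q ∸ k
kp<q⇒[p∸1]*k<q∸k {suc p} {q} {k} _ kp<q = m+n≤o⇒m≤o∸n (suc (p * k)) (begin
  suc (p * k + k)  ≡⟨ cong suc (+-comm (p * k) k) ⟩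
  suc (suc p * k)  ≡⟨ cong suc (*-comm (suc p) k) ⟩
  suc (k * suc p)  ≤⟨ kp<q ⟩
  q                ∎)
  where open ≤-Reasoning

inFamily-≅ : ∀ {G H p q e} → G ≅ H → InFamily p q e H → InFamily p q e G
inFamily-≅ {G} {H} {p} {q} G≅H (H⊆K , edges , noIso , notK) =
  subgraphOfK-≅ {H} {G} {p} {q} H≅G H⊆K , trans (edgeCount-≅ {G} {H} G≅H) edges ,
  noIsolated-≅ {H} {G} H≅G noIso , λ s t G≅K → notK s t (≅-trans {H} {G} {K s t} H≅G G≅K)
  where
  H≅G = ≅-sym {G} {H} G≅H

-- The hypotheses 2 < p and kp + 2 < q of the lemma are used only through (p − 1)k < q − k, and
-- through p ≥ 2 in leftK-inFamily.
module Setting {p q k : ℕ} (k≥1 : 1 ≤ k) (slack : (p ∸ 1) * k < q ∸ k) where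

  k≤q : k ≤ q
  k≤q = ≮⇒≥ λ q<k →
    <⇒≱ slack (subst (_≤ (p ∸ 1) * k) (sym (m≤n⇒m∸n≡0 (<⇒≤ q<k))) z≤n)

  p≤q∸k : p ≤ q ∸ k
  p≤q∸k = begin
    p                   ≤⟨ m≤n+m∸n p 1 ⟩
    suc (p ∸ 1)         ≤⟨ s≤s (m≤m*n (p ∸ 1) k {{>-nonZero k≥1}}) ⟩
    suc ((p ∸ 1) * k)   ≤⟨ slack ⟩
    q ∸ k               ∎
    where open ≤-Reasoning

  [p∸1]*[x+q∸k]<p*[q∸k] : ∀ {x} → 1 ≤ p → x ≤ k → (p ∸ 1) * (x + (q ∸ k)) < p * (q ∸ k)
  [p∸1]*[x+q∸k]<p*[q∸k] {x} 1≤p x≤k = begin-strict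
    (p ∸ 1) * (x + (q ∸ k))          ≡⟨ *-distribˡ-+ (p ∸ 1) x (q ∸ k) ⟩
    (p ∸ 1) * x + (p ∸ 1) * (q ∸ k)  <⟨ +-monoˡ-< _ (≤-<-trans (*-monoʳ-≤ (p ∸ 1) x≤k) slack) ⟩
    (q ∸ k) + (p ∸ 1) * (q ∸ k)      ≡⟨ cong (_* (q ∸ k)) (m+[n∸m]≡n 1≤p) ⟩
    p * (q ∸ k)                      ∎
    where open ≤-Reasoning

  dimensions : ∀ {s t} → s ≤ t → (s ≤ p × t ≤ q) ⊎ (s ≤ q × t ≤ p) → p * (q ∸ k) < s * t →
    s ≡ p × q ∸ k < t × t ≤ q
  dimensions s≤t (inj₂ (_ , t≤p)) e<st =
    ⊥-elim (<⇒≱ e<st (*-mono-≤ (≤-trans s≤t t≤p) (≤-trans t≤p p≤q∸k)))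
  dimensions {s} {t} s≤t (inj₁ (s≤p , t≤q)) e<st = s≡p , q∸k<t , t≤q
    where
    s≮p : ¬ s < p
    s≮p s<p = <⇒≱ e<st (<⇒≤ (begin-strict
      s * t                       ≤⟨ *-mono-≤ (∸-monoˡ-≤ 1 s<p) t≤q ⟩
      (p ∸ 1) * q                 ≡⟨ cong ((p ∸ 1) *_) (sym (m+[n∸m]≡n k≤q)) ⟩
      (p ∸ 1) * (k + (q ∸ k))     <⟨ [p∸1]*[x+q∸k]<p*[q∸k] (≤-trans (s≤s z≤n) s<p) ≤-refl ⟩
      p * (q ∸ k)                 ∎))
      where open ≤-Reasoning
    s≡p : s ≡ p
    s≡p = ≤-antisym s≤p (≮⇒≥ s≮p)
    q∸k<t : q ∸ k < t
    q∸k<t = *-cancelˡ-< p (q ∸ k) t (subst (λ s → p * (q ∸ k) < s * t) s≡p e<st)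

  leftK⊆K⇒shape : ∀ {s t} → 2 ≤ s → s ≤ t → s * t ∸ t < p * (q ∸ k) → p * (q ∸ k) < s * t →
    SubgraphOfK p q (leftK (p * (q ∸ k)) s t) → s ≡ p × ∃[ a ] (a < k × t ≡ q ∸ a)
  leftK⊆K⇒shape 2≤s s≤t st∸t<e e<st L⊆K =
    let c<t = m∸n<o⇒m∸o<n (≤-trans (≤-trans (s≤s z≤n) 2≤s) s≤t) st∸t<e
        sizes = leftK⊆K⇒sizes {p * (q ∸ k)} {p = p} {q} 2≤s c<t L⊆K
        s≡p , q∸k<t , t≤q = dimensions s≤t sizes e<st
    in s≡p , ∸-shift q∸k<t t≤q

  rightK⊈K : ∀ {s t} → 1 ≤ s → s ≤ t → s * t ∸ s < p * (q ∸ k) → p * (q ∸ k) < s * t →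
    ¬ SubgraphOfK p q (rightK (p * (q ∸ k)) s t)
  rightK⊈K {suc zero} {suc zero} _ _ 0<e e<1 _ = <⇒≱ e<1 0<e
  rightK⊈K {suc (suc _)} {suc zero} _ (s≤s ())
  rightK⊈K {s} {t@(suc (suc _))} 1≤s s≤t st∸s<e e<st R⊆K =
    let c<s = m∸n<o⇒m∸o<n 1≤s st∸s<e
        sizes = rightK⊆K⇒sizes {p * (q ∸ k)} {p = p} {q} (s≤s (s≤s z≤n)) c<s R⊆K
        s≡p , q∸k<t , _ = dimensions s≤t sizes e<st
    in <⇒≱ q∸k<t (m*n∸m<m*o⇒n≤o p (subst (λ s → s * t ∸ s < p * (q ∸ k)) s≡p st∸s<e))

  leftForm⇒leftK : ∀ {G} → SubgraphOfK p q G → NoIsolated G → IsLeftForm (p * (q ∸ k)) G →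
    ∃[ a ] (a < k × G ≅ leftK (p * (q ∸ k)) p (q ∸ a))
  leftForm⇒leftK _ _ (zero , _ , () , _)
  leftForm⇒leftK {G} _ noIso (suc zero , t , _ , _ , _ , e<t , G≅L) =
    ⊥-elim (leftK-isolated {p * (q ∸ k)} e<t (noIsolated-≅ {G} {leftK (p * (q ∸ k)) 1 t} G≅L noIso))
  leftForm⇒leftK {G} G⊆K _ (s@(suc (suc _)) , t , _ , s≤t , st∸t<e , e<st , G≅L)
    with leftK⊆K⇒shape (s≤s (s≤s z≤n)) s≤t st∸t<e e<st
           (subgraphOfK-≅ {G} {leftK (p * (q ∸ k)) s t} {p} {q} G≅L G⊆K)
  ... | refl , a , a<k , refl = a , a<k , G≅L

  rightForm⇒⊥ : ∀ {G} → SubgraphOfK p q G → ¬ IsRightForm (p * (q ∸ k)) G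
  rightForm⇒⊥ {G} G⊆K (s , t , 1≤s , s≤t , st∸s<e , e<st , G≅R) =
    rightK⊈K 1≤s s≤t st∸s<e e<st
      (subgraphOfK-≅ {G} {rightK (p * (q ∸ k)) s t} {p} {q} G≅R G⊆K)

  leftK-dims : ∀ {a} → 1 ≤ p → a < k →
    p ≤ q ∸ a × p * (q ∸ a) ∸ (q ∸ a) < p * (q ∸ k) × p * (q ∸ k) < p * (q ∸ a)
  leftK-dims {a} 1≤p a<k = ≤-trans p≤q∸k (∸-monoʳ-≤ q (<⇒≤ a<k)) , lower , upper
    where
    open ≤-Reasoning
    lower : p * (q ∸ a) ∸ (q ∸ a) < p * (q ∸ k)
    lower = begin-strict
      p * (q ∸ a) ∸ (q ∸ a)          ≡⟨ cong (p * (q ∸ a) ∸_) (sym (*-identityˡ (q ∸ a))) ⟩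
      p * (q ∸ a) ∸ 1 * (q ∸ a)      ≡⟨ sym (*-distribʳ-∸ (q ∸ a) p 1) ⟩
      (p ∸ 1) * (q ∸ a)              ≡⟨ cong ((p ∸ 1) *_) (m∸o≡[n∸o]+[m∸n] (<⇒≤ a<k) k≤q) ⟩
      (p ∸ 1) * ((k ∸ a) + (q ∸ k))  <⟨ [p∸1]*[x+q∸k]<p*[q∸k] 1≤p (m∸n≤m k a) ⟩
      p * (q ∸ k)                    ∎
    upper : p * (q ∸ k) < p * (q ∸ a)
    upper = *-monoʳ-< p {{>-nonZero 1≤p}} (∸-monoʳ-< a<k k≤q)

  leftK-deficit : ∀ {a} → a ≤ k → p * (q ∸ a) ∸ p * (q ∸ k) ≡ (k ∸ a) * p
  leftK-deficit {a} a≤k = begin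
    p * (q ∸ a) ∸ p * (q ∸ k)        ≡⟨ sym (*-distribˡ-∸ p (q ∸ a) (q ∸ k)) ⟩
    p * (q ∸ a ∸ (q ∸ k))            ≡⟨ cong (λ x → p * (x ∸ (q ∸ k))) (m∸o≡[n∸o]+[m∸n] a≤k k≤q) ⟩
    p * ((k ∸ a) + (q ∸ k) ∸ (q ∸ k)) ≡⟨ cong (p *_) (m+n∸n≡m (k ∸ a) (q ∸ k)) ⟩
    p * (k ∸ a)                      ≡⟨ *-comm p (k ∸ a) ⟩
    (k ∸ a) * p                      ∎
    where open ≡-Reasoning

  leftK-inFamily : ∀ {a} → 2 ≤ p → a < k →
    InFamily p q (p * (q ∸ k)) (leftK (p * (q ∸ k)) p (q ∸ a))
  leftK-inFamily {a} 2≤p a<k =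
    let p≤t , lower , upper = leftK-dims 1≤p a<k
        c<t = m∸n<o⇒m∸o<n (≤-trans 1≤p p≤t) lower
    in Bip⊆K _ (m∸n≤m q a) , edgeCount-leftK 1≤p (<⇒≤ c<t) (<⇒≤ upper) ,
       leftK-noIsolated {e} 2≤p c<t ,
       λ s′ t′ → leftK-≇K {e} {p = s′} {q = t′} (m<n⇒0<n∸m upper) c<t
    where
    e = p * (q ∸ k)
    1≤p = ≤-trans (s≤s z≤n) 2≤p

lemma2p4 : (p q k e : ℕ) → 1 ≤ k → 2 < p → k * p + 2 < q → e ≡ p * (q ∸ k) →
    ((G : Graph) →
      (InFamily p q e G × (IsLeftForm e G ⊎ IsRightForm e G))
        ⇔ (∃[ a ] (a < k × G ≅ leftK e p (q ∸ a))))
    × (∀ a b → a < k → b < k → leftK e p (q ∸ a) ≅ leftK e p (q ∸ b) → a ≡ b)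
    × (∀ a → a < k → leftK e p (q ∸ a) ≅ DegGraph p (q ∸ a) (dSeq p q k a))
lemma2p4 p q k _ k≥1 p>2 q>kp+2 refl = (λ G → mk⇔ (forward G) (backward G)) , a-unique , degrees
  where
  e = p * (q ∸ k)
  1≤p = ≤-trans (s≤s z≤n) p>2
  slack = kp<q⇒[p∸1]*k<q∸k 1≤p (≤-<-trans (m≤m+n (k * p) 2) q>kp+2)
  open Setting {p} {q} {k} k≥1 slack

  forward : ∀ G → InFamily p q e G × (IsLeftForm e G ⊎ IsRightForm e G) →
    ∃[ a ] (a < k × G ≅ leftK e p (q ∸ a))
  forward G ((G⊆K , _ , noIso , _) , inj₁ left) = leftForm⇒leftK {G} G⊆K noIso left
  forward G ((G⊆K , _) , inj₂ right) = ⊥-elim (rightForm⇒⊥ {G} G⊆K right)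

  backward : ∀ G → ∃[ a ] (a < k × G ≅ leftK e p (q ∸ a)) →
    InFamily p q e G × (IsLeftForm e G ⊎ IsRightForm e G)
  backward G (a , a<k , G≅L) =
    let p≤t , lower , upper = leftK-dims 1≤p a<k
    in inFamily-≅ {G} {leftK e p (q ∸ a)} {p} {q} G≅L (leftK-inFamily (<⇒≤ p>2) a<k) ,
       inj₁ (p , q ∸ a , 1≤p , p≤t , lower , upper , G≅L)

  a-unique : ∀ a b → a < k → b < k → leftK e p (q ∸ a) ≅ leftK e p (q ∸ b) → a ≡ b
  a-unique a b a<k b<k La≅Lb = ∸-cancelˡ-≡ (≤-trans (<⇒≤ a<k) k≤q) (≤-trans (<⇒≤ b<k) k≤q)
    (+-cancelˡ-≡ p _ _ (≅⇒n≡ {leftK e p (q ∸ a)} {leftK e p (q ∸ b)} La≅Lb))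

  degrees : ∀ a → a < k → leftK e p (q ∸ a) ≅ DegGraph p (q ∸ a) (dSeq p q k a)
  degrees a a<k = leftK≅DegGraph {e} (dSeq p q k a) λ i →
    cong (λ c → if toℕ i ≡ᵇ p ∸ 1 then q ∸ a ∸ c else q ∸ a) (sym (leftK-deficit (<⇒≤ a<k)))
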